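{- Any tree decomposition of a connected graph $\mathcal{G}$ is also a vertex-cut tree of $\mathcal{G}$. Consequently, $\kappa_{\text{vc-tree}}(\mathcal{G})\le\kappa_{\text{tree}}(\mathcal{G})+1$ and $\kappa_{\text{vc-path}}(\mathcal{G})\le\kappa_{\text{path}}(\mathcal{G})+1$.
   Context: Graphs are finite. For a graph $\mathcal{G}=(V,E)$ and $W\subseteq V$, $N(W)$ is the set of vertices adjacent to some vertex of $W$. An ordered collection $(V_0,V_1,\ldots,V_\delta)$ of subsets of $V$ is a star partition of $V$ if the $V_i$ are pairwise disjoint (some possibly empty), their union is $V$, and $N(V_i)\subseteq V_i\cup V_0$ for each $i\ge1$. For a vertex $z$ of degree $\delta$ in a tree $T$, $T_1^{(z)},\ldots,T_\delta^{(z)}$ denote the components of $T-z$. For a map $\beta:V(T)\to 2^{V(\mathcal{G})}$ and $X\subseteq V(T)$, $\beta(X)=\bigcup_{x\in X}\beta(x)$. A vertex-cut tree of a connected graph $\mathcal{G}$ is a pair $(T,\beta)$ with $T$ a tree and $\beta:V(T)\to2^{V(\mathcal{G})}$ such that (VC1) $\beta(V(T))=V(\mathcal{G})$; (VC2) for all $x,y\in V(T)$ and every $z$ on the path from $x$ to $y$ in $T$, $\beta(x)\cap\beta(y)\subseteq\beta(z)$; (VC3) for each $z\in V(T)$ of degree $\delta$, $(\beta(z),V_1,\ldots,V_\delta)$ is a star partition of $V(\mathcal{G})$, where $V_i=\beta(V(T_i^{(z)}))\setminus\beta(z)$. It is a vertex-cut path if $T$ is a path. Its vc-width is $\max_{z\in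 V(T)}|\beta(z)|$; $\kappa_{\text{vc-tree}}(\mathcal{G})$ (resp. $\kappa_{\text{vc-path}}(\mathcal{G})$) is the least vc-width over all vertex-cut trees (resp. vertex-cut paths) of $\mathcal{G}$. A tree decomposition of a connected graph $\mathcal{G}$ is a pair $(T,\beta)$ with $T$ a tree and $\beta:V(T)\to2^{V(\mathcal{G})}$ satisfying (T1) $\beta(V(T))=V(\mathcal{G})$; (T2) the same condition as (VC2); (T3) for each pair of adjacent vertices $u,v$ of $\mathcal{G}$ there is $z\in V(T)$ with $\{u,v\}\subseteq\beta(z)$. It is a path decomposition if $T$ is a path. Its width is $\max_{z}|\beta(z)|-1$; $\kappa_{\text{tree}}(\mathcal{G})$ (resp. $\kappa_{\text{path}}(\mathcal{G})$) is the minimum width over all tree (resp. path) decompositions of $\mathcal{G}$. -}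

module Defs where

open import Level using (0ℓ)
open import Data.Nat using (ℕ; zero; suc; _≤_; _<_; _⊔_; _∸_; _+_)
open import Data.Fin using (Fin)
open import Data.Fin.Subset using (Subset; _∈_; _∉_; ∣_∣)
open import Data.List using (List; []; _∷_; length)
open import Data.List.Relation.Unary.Unique.Propositional using (Unique)
import Data.List.Membership.Propositional as LM
open import Data.Vec.Functional using (foldr)
open import Data.Product using (Σ; ∃; ∃-syntax; _×_; _,_)
open import Data.Sum using (_⊎_)
open import Relation.Nullary using (¬_)
open import Relation.Binary.PropositionalEquality using (_≡_; _≢_)

record Graph (n : ℕ) : Set₁ where
  field
    Adj     : Fin n → Fin n → Set
    sym     : ∀ {x y} → Adj x y → Adj y x
    irrefl  : ∀ {x} → ¬ Adj x x
open Graph public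

module _ {n : ℕ} (G : Graph n) where

  data Walk : Fin n → Fin n → List (Fin n) → Set where
    here : ∀ {x} → Walk x x (x ∷ [])
    step : ∀ {x y z p} → Adj G x y → Walk y z p → Walk x z (x ∷ p)

  IsPath : Fin n → Fin n → List (Fin n) → Set
  IsPath x y p = Walk x y p × Unique p

  Connected : Set
  Connected = (0 < n) × (∀ x y → ∃[ p ] Walk x y p)

  HasCycle : Set
  HasCycle = ∃[ x ] ∃[ y ] ∃[ p ] (IsPath x y p × 3 ≤ length p × Adj G y x)

  IsTree : Set
  IsTree = Connected × ¬ HasCycle

  MaxDeg≤2 : Set
  MaxDeg≤2 = ∀ x a b c → Adj G x a → Adj G x b → Adj G x c →
             (a ≡ b) ⊎ (a ≡ c) ⊎ (b ≡ c)

  IsPathGraph : Set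
  IsPathGraph = IsTree × MaxDeg≤2

  -- z lies on the path from x to y (unique in a tree)
  OnPath : Fin n → Fin n → Fin n → Set
  OnPath x y z = ∃[ p ] (IsPath x y p × z LM.∈ p)

  SameComp : Fin n → Fin n → Fin n → Set
  SameComp z x y = ∃[ p ] (Walk x y p × ¬ (z LM.∈ p))

  InN : (Fin n → Set) → Fin n → Set
  InN W v = ∃[ w ] (W w × Adj G w v)

module _ {n : ℕ} (G : Graph n) {m : ℕ} (T : Graph m) (β : Fin m → Subset n) where

  Covers : Set
  Covers = ∀ v → ∃[ x ] (v ∈ β x)

  Interpolates : Set
  Interpolates = ∀ x y z → OnPath T x y z → ∀ v → v ∈ β x → v ∈ β y → v ∈ β z

  CoversEdges : Set
  CoversEdges = ∀ u v → Adj G u v → ∃[ z ] (u ∈ β z × v ∈ β z)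

  -- V_i for the component of T - z containing x (x ≠ z):
  -- β(V(T_i^{(z)})) \ β(z)
  CompPart : Fin m → Fin m → Fin n → Set
  CompPart z x v = (∃[ y ] (SameComp T z x y × v ∈ β y)) × v ∉ β z

  -- (VC3): (β(z), V_1, ..., V_δ) is a star partition of V(G), where the
  -- V_i range over the components of T - z (each given by a vertex x ≠ z in it).
  -- Disjointness of each V_i from β(z) holds by definition of V_i.
  StarPartitionAt : Fin m → Set
  StarPartitionAt z =
      (∀ x y → x ≢ z → y ≢ z → ¬ SameComp T z x y →
         ∀ v → CompPart z x v → ¬ CompPart z y v)
    ×
      (∀ v → v ∈ β z ⊎ ∃[ x ] (x ≢ z × CompPart z x v))
    ×
      (∀ x → x ≢ z → ∀ v → InN G (CompPart z x) v → CompPart z x v ⊎ v ∈ β z)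

  IsTreeDecomposition : Set
  IsTreeDecomposition = IsTree T × Covers × Interpolates × CoversEdges

  IsPathDecomposition : Set
  IsPathDecomposition = IsPathGraph T × Covers × Interpolates × CoversEdges

  IsVertexCutTree : Set
  IsVertexCutTree = IsTree T × Covers × Interpolates × (∀ z → StarPartitionAt z)

  IsVertexCutPath : Set
  IsVertexCutPath = IsPathGraph T × Covers × Interpolates × (∀ z → StarPartitionAt z)

maxBag : ∀ {n m} → (Fin m → Subset n) → ℕ
maxBag β = foldr _⊔_ 0 (λ z → ∣ β z ∣)

record Decomp (n : ℕ) : Set₁ where
  constructor decomp
  field
    size : ℕ
    tree : Graph size
    bags : Fin size → Subset n
open Decomp public

IsMinOver : ∀ {n} → (Decomp n → Set) → (Decomp n → ℕ) → ℕ → Set₁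
IsMinOver {n} P width k =
  (∃[ D ] (P D × width D ≡ k)) × (∀ (D : Decomp n) → P D → k ≤ width D)

module _ {n : ℕ} (G : Graph n) where

  decompWidth : Decomp n → ℕ
  decompWidth D = maxBag (bags D) ∸ 1

  vcWidth : Decomp n → ℕ
  vcWidth D = maxBag (bags D)

  κ-tree≡ : ℕ → Set₁
  κ-tree≡ = IsMinOver (λ D → IsTreeDecomposition G (tree D) (bags D)) decompWidth

  κ-path≡ : ℕ → Set₁
  κ-path≡ = IsMinOver (λ D → IsPathDecomposition G (tree D) (bags D)) decompWidth

  κ-vc-tree≡ : ℕ → Set₁
  κ-vc-tree≡ = IsMinOver (λ D → IsVertexCutTree G (tree D) (bags D)) vcWidth

  κ-vc-path≡ : ℕ → Set₁
  κ-vc-path≡ = IsMinOver (λ D → IsVertexCutPath G (tree D) (bags D)) vcWidth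

-- A tree decomposition and a vertex-cut tree share (VC1)/(VC2); only the
-- star-partition condition (VC3) at each node z must be derived.  The key
-- fact is a separation property: if a vertex v of G lies in the bags of a
-- and b but not in β(z), then a and b lie in the same component of T - z.
-- Indeed, shorten a walk from a to b to a path; if it passed through z,
-- interpolation (VC2) would put v into β(z).  Components of T - z are
-- handled through walks avoiding z, which form an equivalence relation.
-- With separation, disjointness of the parts V_i and the neighbourhood
-- condition N(V_i) ⊆ V_i ∪ β(z) follow (the latter from edge coverage (T3)).  The width bounds follow
-- from a general comparison of minima: if every P-decomposition is a
-- Q-decomposition of Q-width at most its P-width + 1, then min_Q ≤ min_P + 1.
module Submission where

open import Defs
open import Data.Nat using (ℕ; _≤_; _+_; _∸_)
open import Data.Nat.Properties using (≤-trans; +-comm; m≤n+m∸n)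
open import Data.Fin using (Fin; _≟_)
open import Data.Fin.Subset using (Subset)
open import Data.Fin.Subset renaming (_∈_ to _∈ₛ_; _∉_ to _∉ₛ_) using ()
open import Data.Fin.Subset.Properties using () renaming (_∈?_ to _∈ₛ?_)
open import Data.Product using (_×_; _,_; ∃; proj₁; proj₂)
open import Data.Sum using (_⊎_; inj₁; inj₂)
open import Data.Empty using (⊥-elim)
open import Data.List using (_∷_)
open import Data.List.Relation.Unary.Any using (here; there)
open import Data.List.Relation.Unary.AllPairs using ([]; _∷_)
open import Data.List.Relation.Unary.Unique.Propositional using (Unique)
import Data.List.Relation.Unary.All as All
open import Data.List.Relation.Unary.All.Properties using (¬Any⇒All¬)
open import Data.List.Membership.Propositional using (_∈_)
open import Relation.Nullary using (yes; no; ¬_)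
open import Relation.Binary.PropositionalEquality
  using (_≡_; _≢_; refl; subst) renaming (sym to ≡-sym)

module Walks {m : ℕ} (T : Graph m) where

  open import Data.List.Membership.DecPropositional (_≟_ {m}) using (_∈?_)

  suffixPath : ∀ {x y z q} → Walk T y z q → x ∈ q → Unique q →
               ∃ λ s → IsPath T x z s
  suffixPath here        (here refl)  u       = _ , here , u
  suffixPath (step y~ w) (here refl)  u       = _ , step y~ w , u
  suffixPath (step _ w)  (there x∈q) (_ ∷ u) = suffixPath w x∈q u

  -- Every walk shortens to a path with the same endpoints: when the first
  -- vertex recurs later, cut out the loop via suffixPath.
  walkToPath : ∀ {x z p} → Walk T x z p → ∃ λ q → IsPath T x z q
  walkToPath here = _ , here , (All.[] ∷ [])
  walkToPath (step {x} x~y w) with walkToPath w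
  ... | q , wq , uq with x ∈? q
  ...   | yes x∈q = suffixPath wq x∈q uq
  ...   | no  x∉q = x ∷ q , step x~y wq , (¬Any⇒All¬ q x∉q ∷ uq)

  -- Walks in T that never visit z, indexed by their endpoints; unlike
  -- SameComp this omits the vertex list, which makes composition easy.
  data Avoiding (z : Fin m) : Fin m → Fin m → Set where
    stay : ∀ {x} → x ≢ z → Avoiding z x x
    move : ∀ {x y w} → x ≢ z → Adj T x y → Avoiding z y w → Avoiding z x w

  avoid-trans : ∀ {z a b c} → Avoiding z a b → Avoiding z b c → Avoiding z a c
  avoid-trans (stay _)        q = q
  avoid-trans (move a≢z a~ p) q = move a≢z a~ (avoid-trans p q)

  avoid-start : ∀ {z a b} → Avoiding z a b → a ≢ z
  avoid-start (stay a≢z)     = a≢z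
  avoid-start (move a≢z _ _) = a≢z

  avoid-sym : ∀ {z a b} → Avoiding z a b → Avoiding z b a
  avoid-sym (stay a≢z)        = stay a≢z
  avoid-sym (move a≢z a~y p) =
    avoid-trans (avoid-sym p) (move (avoid-start p) (Graph.sym T a~y) (stay a≢z))

  walk⇒avoiding : ∀ {z x y p} → Walk T x y p → ¬ (z ∈ p) → Avoiding z x y
  walk⇒avoiding here         z∉p = stay (λ x≡z → z∉p (here (≡-sym x≡z)))
  walk⇒avoiding (step x~ w) z∉p =
    move (λ x≡z → z∉p (here (≡-sym x≡z))) x~ (walk⇒avoiding w (λ k → z∉p (there k)))

  sameComp⇒avoiding : ∀ {z x y} → SameComp T z x y → Avoiding z x y
  sameComp⇒avoiding (_ , w , z∉p) = walk⇒avoiding w z∉p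

  avoiding⇒sameComp : ∀ {z x y} → Avoiding z x y → SameComp T z x y
  avoiding⇒sameComp (stay x≢z) =
    _ , here , λ { (here e) → x≢z (≡-sym e) ; (there ()) }
  avoiding⇒sameComp {x = x} (move x≢z x~ p) with avoiding⇒sameComp p
  ... | q , w , z∉q =
    x ∷ q , step x~ w , λ { (here e) → x≢z (≡-sym e) ; (there k) → z∉q k }

  sameComp-trans : ∀ {z a b c} → SameComp T z a b → SameComp T z b c → SameComp T z a c
  sameComp-trans p q =
    avoiding⇒sameComp (avoid-trans (sameComp⇒avoiding p) (sameComp⇒avoiding q))

  sameComp-sym : ∀ {z a b} → SameComp T z a b → SameComp T z b a
  sameComp-sym p = avoiding⇒sameComp (avoid-sym (sameComp⇒avoiding p))

module _ {n : ℕ} (G : Graph n) {m : ℕ} (T : Graph m) (β : Fin m → Subset n)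
         (T-connected : Connected T) (interpolates : Interpolates G T β) where
  open Walks T
  open import Data.List.Membership.DecPropositional (_≟_ {m}) using (_∈?_)

  separation : ∀ z a b v → v ∈ₛ β a → v ∈ₛ β b → v ∉ₛ β z → SameComp T z a b
  separation z a b v v∈a v∈b v∉z with proj₂ T-connected a b
  ... | _ , walk with walkToPath walk
  ...   | q , path with z ∈? q
  ...     | yes z∈q = ⊥-elim (v∉z (interpolates a b z (q , path , z∈q) v v∈a v∈b))
  ...     | no  z∉q = avoiding⇒sameComp (walk⇒avoiding (proj₁ path) z∉q)

  parts-disjoint : ∀ z x y → ¬ SameComp T z x y →
                   ∀ v → CompPart G T β z x v → ¬ CompPart G T β z y v
  parts-disjoint z x y x≁y v ((a , x~a , v∈a) , v∉z) ((b , y~b , v∈b) , _) =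
    x≁y (sameComp-trans x~a
          (sameComp-trans (separation z a b v v∈a v∈b v∉z) (sameComp-sym y~b)))

  parts-cover : Covers G T β → ∀ z v → v ∈ₛ β z ⊎ ∃ λ x → x ≢ z × CompPart G T β z x v
  parts-cover covers z v with v ∈ₛ? β z
  ... | yes v∈z = inj₁ v∈z
  ... | no  v∉z with covers v
  ...   | x , v∈x = inj₂ (x , x≢z , ((x , avoiding⇒sameComp (stay x≢z) , v∈x) , v∉z))
    where
    x≢z : x ≢ z
    x≢z x≡z = v∉z (subst (λ t → v ∈ₛ β t) x≡z v∈x)

  -- N(V_x) ⊆ V_x ∪ β(z): an edge uv with u ∈ V_x lies in some bag t, and
  -- separation at u puts t in the component of x.
  parts-closed : CoversEdges G T β → ∀ z x v → InN G (CompPart G T β z x) v →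
                 CompPart G T β z x v ⊎ v ∈ₛ β z
  parts-closed coversEdges z x v (u , ((a , x~a , u∈a) , u∉z) , u~v) with v ∈ₛ? β z
  ... | yes v∈z = inj₂ v∈z
  ... | no  v∉z with coversEdges u v u~v
  ...   | t , u∈t , v∈t =
    inj₁ ((t , sameComp-trans x~a (separation z a t u u∈a u∈t u∉z) , v∈t) , v∉z)

  starPartition : Covers G T β → CoversEdges G T β → ∀ z → StarPartitionAt G T β z
  starPartition covers coversEdges z =
      (λ x y _ _ → parts-disjoint z x y)
    , parts-cover covers z
    , (λ x _ → parts-closed coversEdges z x)

minimum-≤-suc : ∀ {n} (P Q : Decomp n → Set) (widthP widthQ : Decomp n → ℕ) →
  (∀ D → P D → Q D) → (∀ D → widthQ D ≤ widthP D + 1) →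
  ∀ kQ kP → IsMinOver Q widthQ kQ → IsMinOver P widthP kP → kQ ≤ kP + 1
minimum-≤-suc P Q widthP widthQ P⇒Q width≤ kQ kP (_ , kQ-least) ((D , PD , refl) , _) =
  ≤-trans (kQ-least D (P⇒Q D PD)) (width≤ D)

vcWidth≤decompWidth+1 : ∀ {n} (G : Graph n) D → vcWidth G D ≤ decompWidth G D + 1
vcWidth≤decompWidth+1 G D =
  subst (maxBag (bags D) ≤_) (+-comm 1 (maxBag (bags D) ∸ 1)) (m≤n+m∸n (maxBag (bags D)) 1)

treeDecomposition⇒vertexCutTree : ∀ {n} (G : Graph n) {m} (T : Graph m) β →
  IsTreeDecomposition G T β → IsVertexCutTree G T β
treeDecomposition⇒vertexCutTree G T β (tree , covers , interp , coversEdges) =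
  tree , covers , interp , starPartition G T β (proj₁ tree) interp covers coversEdges

pathDecomposition⇒vertexCutPath : ∀ {n} (G : Graph n) {m} (T : Graph m) β →
  IsPathDecomposition G T β → IsVertexCutPath G T β
pathDecomposition⇒vertexCutPath G T β (path , covers , interp , coversEdges) =
  path , covers , interp , starPartition G T β (proj₁ (proj₁ path)) interp covers coversEdges

lemma5p6 : ∀ {n} (G : Graph n) → Connected G →
    (∀ {m} (T : Graph m) (β : Fin m → Subset n) →
       IsTreeDecomposition G T β → IsVertexCutTree G T β)
    × (∀ kvc kt → κ-vc-tree≡ G kvc → κ-tree≡ G kt → kvc ≤ kt + 1)
    × (∀ kvc kp → κ-vc-path≡ G kvc → κ-path≡ G kp → kvc ≤ kp + 1)
lemma5p6 G _ =
    treeDecomposition⇒vertexCutTree G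
  , minimum-≤-suc _ _ (decompWidth G) (vcWidth G)
      (λ D → treeDecomposition⇒vertexCutTree G (tree D) (bags D))
      (vcWidth≤decompWidth+1 G)
  , minimum-≤-suc _ _ (decompWidth G) (vcWidth G)
      (λ D → pathDecomposition⇒vertexCutPath G (tree D) (bags D))
      (vcWidth≤decompWidth+1 G)
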